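{- Let $A$ be a complete model and $B$ a model such that $A\succsim_\rho B$ and $B\succsim_\pi A$ for some injection $\rho:\mathrm{dom}\,B\to\mathrm{dom}\,A$ and some bijection $\pi:\mathrm{dom}\,A\to\mathrm{dom}\,B$. Then $A$ and $B$ are strongly equivalent.
   Context: A model of computation over a set $X$ is any set of functions $f:X\to X\cup\{\bot\}$, where $\bot$ denotes "undefined". Injections are extended by $\rho(\bot)=\bot$. $A\succsim_\rho B$ means: for every $g\in B$ there is $f\in A$ with $\rho\circ g=f\circ\rho$; $A\succsim B$ means $A\succsim_\rho B$ for some injection $\rho$. $A$ and $B$ are strongly equivalent if there are bijections $\sigma:\mathrm{dom}\,B\to\mathrm{dom}\,A$, $\tau:\mathrm{dom}\,A\to\mathrm{dom}\,B$ with $A\succsim_\sigma B$ and $B\succsim_\tau A$. A model $A$ is complete if for every model $M$ over $\mathrm{dom}\,A$ with $M\supseteq A$ and $A\succsim M$, we have $M=A$. -}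

module Defs where

open import Level using (0ℓ)
open import Data.Maybe using (Maybe; nothing; just)
open import Data.Maybe.Base using (map)
open import Data.Product using (Σ; _×_; ∃)
open import Relation.Unary using (Pred; _∈_)
open import Relation.Binary.PropositionalEquality using (_≡_)
open import Function.Definitions using (Injective; Bijective)

-- A partial function X → X ∪ {⊥}; ⊥ is represented by 'nothing'.
PFun : Set → Set
PFun X = X → Maybe X

Model : Set → Set₁
Model X = Pred (PFun X) 0ℓ

-- Set-theoretic inclusion of models; functions are compared extensionally
-- (as set-theoretic functions are), i.e. pointwise.
_⊆ₘ_ : {X : Set} → Model X → Model X → Set
_⊆ₘ_ {X} M N = (g : PFun X) → g ∈ M → Σ (PFun X) λ f → f ∈ N × ((x : X) → f x ≡ g x)

_≐ₘ_ : {X : Set} → Model X → Model X → Set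
M ≐ₘ N = (M ⊆ₘ N) × (N ⊆ₘ M)

-- A ≿_ρ B : for every g ∈ B there is f ∈ A with ρ ∘ g = f ∘ ρ
-- (ρ extended to ⊥ by ρ(⊥) = ⊥, i.e. Maybe.map ρ).
Simulates : {X Y : Set} → Model X → (Y → X) → Model Y → Set
Simulates {X} {Y} A ρ B =
  (g : PFun Y) → g ∈ B → Σ (PFun X) λ f → f ∈ A × ((y : Y) → map ρ (g y) ≡ f (ρ y))

Simulates∃ : {X Y : Set} → Model X → Model Y → Set
Simulates∃ {X} {Y} A B = Σ (Y → X) λ ρ → Injective _≡_ _≡_ ρ × Simulates A ρ B

StronglyEquivalent : {X Y : Set} → Model X → Model Y → Set
StronglyEquivalent {X} {Y} A B =
  Σ (Y → X) λ σ → Σ (X → Y) λ τ →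
    Bijective _≡_ _≡_ σ × Bijective _≡_ _≡_ τ × Simulates A σ B × Simulates B τ A

Complete : {X : Set} → Model X → Set₁
Complete {X} A = (M : Model X) → A ⊆ₘ M → Simulates∃ A M → M ≐ₘ A

-- Conjugating B by the bijection π gives the model M = {π⁻¹ ∘ g ∘ π | g ∈ B}
-- over dom A. Since B ≿_π A, every f ∈ A lies in M; since A ≿_ρ B, A ≿_{ρ∘π} M.
-- Completeness of A forces M = A, and M ⊆ A says precisely that A ≿_{π⁻¹} B.
module Submission where

open import Defs
open import Data.Product using (_×_; _,_; proj₁; Σ)
open import Data.Maybe using (Maybe)
open import Data.Maybe.Base using (map)
open import Data.Maybe.Properties using (map-∘; map-cong; map-id)
open import Relation.Binary.PropositionalEquality
  using (_≡_; refl; sym; trans; cong; module ≡-Reasoning)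
open import Function using (_∘_; _↔_; Inverse; mk⤖; Bijection)
open import Function.Definitions using (Injective; Bijective)
open import Function.Properties.Bijection using (⤖⇒↔)
open import Function.Properties.Inverse using (↔-sym; ↔⇒⤖)
import Function.Construct.Composition as Compose

map-cancel : {X Y : Set} {σ : Y → X} {τ : X → Y} →
  (∀ x → σ (τ x) ≡ x) → (m : Maybe X) → map σ (map τ m) ≡ m
map-cancel {σ = σ} {τ} στ m = begin
  map σ (map τ m)  ≡⟨ map-∘ m ⟨
  map (σ ∘ τ) m    ≡⟨ map-cong στ m ⟩
  map (λ x → x) m  ≡⟨ map-id m ⟩
  m                ∎
  where open ≡-Reasoning

conjugate : {X Y : Set} → (Y → X) → (X → Y) → Model Y → Model X
conjugate {X} σ τ B h = Σ (PFun _) λ g → B g × ((x : X) → h x ≡ map σ (g (τ x)))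

module _ {X Y : Set} {σ : Y → X} {τ : X → Y} where

  ⊆-conjugate : {A : Model X} {B : Model Y} →
    (∀ x → σ (τ x) ≡ x) → Simulates B τ A → A ⊆ₘ conjugate σ τ B
  ⊆-conjugate στ simBA f f∈A with simBA f f∈A
  ... | g , g∈B , τf≡gτ =
    f , (g , g∈B , λ x → trans (sym (map-cancel στ (f x))) (cong (map σ) (τf≡gτ x)))
      , λ _ → refl

  simulates-conjugate : {Z : Set} {A : Model Z} {B : Model Y} {ρ : Y → Z} →
    (∀ y → τ (σ y) ≡ y) → Simulates A ρ B → Simulates A (ρ ∘ τ) (conjugate σ τ B)
  simulates-conjugate {ρ = ρ} τσ simAB h (g , g∈B , h≡σgτ) with simAB g g∈B
  ... | f , f∈A , ρg≡fρ = f , f∈A , λ x → begin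
    map (ρ ∘ τ) (h x)                ≡⟨ cong (map (ρ ∘ τ)) (h≡σgτ x) ⟩
    map (ρ ∘ τ) (map σ (g (τ x)))    ≡⟨ map-∘ (map σ (g (τ x))) ⟩
    map ρ (map τ (map σ (g (τ x))))  ≡⟨ cong (map ρ) (map-cancel τσ (g (τ x))) ⟩
    map ρ (g (τ x))                  ≡⟨ ρg≡fρ (τ x) ⟩
    f (ρ (τ x))                      ∎
    where open ≡-Reasoning

  conjugate-⊆⇒simulates : {A : Model X} {B : Model Y} →
    (∀ y → τ (σ y) ≡ y) → conjugate σ τ B ⊆ₘ A → Simulates A σ B
  conjugate-⊆⇒simulates τσ M⊆A g g∈B
    with M⊆A (λ x → map σ (g (τ x))) (g , g∈B , λ _ → refl)
  ... | f , f∈A , f≡σgτ = f , f∈A , λ y → begin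
    map σ (g y)            ≡⟨ cong (map σ ∘ g) (τσ y) ⟨
    map σ (g (τ (σ y)))    ≡⟨ f≡σgτ (σ y) ⟨
    f (σ y)                ∎
    where open ≡-Reasoning

mainTheorem16 : {X Y : Set} (A : Model X) (B : Model Y) →
    Complete A →
    (ρ : Y → X) → Injective _≡_ _≡_ ρ → Simulates A ρ B →
    (π : X → Y) → Bijective _≡_ _≡_ π → Simulates B π A →
    StronglyEquivalent A B
mainTheorem16 {X} {Y} A B complete ρ ρ-inj simAB π π-bij simBA =
  π⁻¹ , π , Bijection.bijective (↔⇒⤖ (↔-sym π↔)) , π-bij , simAB⁻¹ , simBA
  where
  π↔ : X ↔ Y
  π↔ = ⤖⇒↔ (mk⤖ π-bij)
  open Inverse π↔ using (strictlyInverseˡ; strictlyInverseʳ) renaming (from to π⁻¹)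

  M⊆A : conjugate π⁻¹ π B ⊆ₘ A
  M⊆A = proj₁ (complete (conjugate π⁻¹ π B)
    (⊆-conjugate strictlyInverseʳ simBA)
    (ρ ∘ π , Compose.injective _≡_ _≡_ _≡_ (proj₁ π-bij) ρ-inj ,
      simulates-conjugate strictlyInverseˡ simAB))

  simAB⁻¹ : Simulates A π⁻¹ B
  simAB⁻¹ = conjugate-⊆⇒simulates strictlyInverseˡ M⊆A
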